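{- Let $(T_r)_{r\in\mathbb{Z}}$ be the Tribonacci sequence. Then for every non-negative integer $k$: \[ 16\sum_{j=0}^k T_{4j-1}^2 = 15T_{4k-1}^2 + 4T_{4k-2}^2 - 2T_{4k-4}^2 - T_{4k-5}^2 . \]
   Context: The Tribonacci sequence $(T_r)_{r\in\mathbb{Z}}$ is defined by $T_0=0$, $T_1=1$, $T_2=1$ and $T_r=T_{r-1}+T_{r-2}+T_{r-3}$ for all integers $r$ (this determines $T_r$ for negative $r$ as well, e.g. $T_{ -1}=0$). -}

module Defs where

open import Data.Nat using (ℕ; zero; suc)
open import Data.Integer using (ℤ; +_; -[1+_]; _+_; _-_; _*_)
open import Data.Product using (_×_; _,_; proj₁)
open import Data.List using (List; map; foldr; upTo)

fwd : ℕ → ℤ × ℤ × ℤ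
fwd zero = (+ 0 , + 1 , + 1)
fwd (suc n) = step (fwd n)
  where
  step : ℤ × ℤ × ℤ → ℤ × ℤ × ℤ
  step (a , b , c) = (b , c , a + b + c)

-- Triple (T_{-n}, T_{-n+1}, T_{-n+2}) for n ≥ 0, by the recurrence run backwards:
-- T_{r-3} = T_r - T_{r-1} - T_{r-2}.
bwd : ℕ → ℤ × ℤ × ℤ
bwd zero = (+ 0 , + 1 , + 1)
bwd (suc n) = step (bwd n)
  where
  step : ℤ × ℤ × ℤ → ℤ × ℤ × ℤ
  step (a , b , c) = (c - b - a , a , b)

T : ℤ → ℤ
T (+ n) = proj₁ (fwd n)
T -[1+ n ] = proj₁ (bwd (suc n))

sq : ℤ → ℤ
sq x = x * x

sumTo : ℕ → (ℕ → ℤ) → ℤ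
sumTo k f = foldr _+_ (+ 0) (map f (upTo (suc k)))

-- The recurrence holds on all of ℤ, so each window (T_r, …, T_{r+8}) is a polynomial in
-- (T_r, T_{r+1}, T_{r+2}). For a window s put Φ(s) = 15 s₄² + 4 s₃² − 2 s₁² − s₀²; a ring
-- identity in the three initial values gives Φ(s shifted by 4) = Φ(s) + 16 s₈². Taking the
-- window at r = 4k − 5, the right-hand side of the theorem is Φ of it, and the formula
-- telescopes from k = 0, where both sides equal 16 T_{−1}² = 0.
module Submission where

open import Defs
open import Data.Nat using (ℕ; zero; suc)
import Data.Nat as ℕ
open import Data.Integer using (ℤ; +_; -[1+_]; _+_; _-_; _*_)
open import Data.Integer.Properties using (+-identityˡ; +-identityʳ; +-assoc; *-distribˡ-+)
open import Data.Integer.Tactic.RingSolver using (solve-∀)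
open import Data.List using (List; []; _∷_; [_]; _∷ʳ_; map; foldr; upTo)
open import Data.List.Properties using (foldr-∷ʳ; map-++; upTo-∷ʳ)
open import Function using (_∘_)
open import Relation.Binary.PropositionalEquality
  using (_≡_; refl; sym; trans; cong; cong₂; module ≡-Reasoning)

open ≡-Reasoning

foldr-+-init : ∀ (xs : List ℤ) a → foldr _+_ a xs ≡ foldr _+_ (+ 0) xs + a
foldr-+-init []       a = sym (+-identityˡ a)
foldr-+-init (x ∷ xs) a = trans (cong (_+_ x) (foldr-+-init xs a))
                                (sym (+-assoc x (foldr _+_ (+ 0) xs) a))

sumTo-suc : ∀ k f → sumTo (suc k) f ≡ sumTo k f + f (suc k)
sumTo-suc k f = begin
  foldr _+_ (+ 0) (map f (upTo (suc (suc k))))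
    ≡⟨ cong (foldr _+_ (+ 0) ∘ map f) (sym (upTo-∷ʳ (suc k))) ⟩
  foldr _+_ (+ 0) (map f (upTo (suc k) ∷ʳ suc k))
    ≡⟨ cong (foldr _+_ (+ 0)) (map-++ f (upTo (suc k)) [ suc k ]) ⟩
  foldr _+_ (+ 0) (map f (upTo (suc k)) ∷ʳ f (suc k))
    ≡⟨ foldr-∷ʳ _+_ (+ 0) (f (suc k)) (map f (upTo (suc k))) ⟩
  foldr _+_ (f (suc k) + + 0) (map f (upTo (suc k)))
    ≡⟨ foldr-+-init (map f (upTo (suc k))) (f (suc k) + + 0) ⟩
  sumTo k f + (f (suc k) + + 0)
    ≡⟨ cong (_+_ (sumTo k f)) (+-identityʳ (f (suc k))) ⟩
  sumTo k f + f (suc k) ∎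

trib : ℤ → ℤ → ℤ → ℕ → ℤ
trib a b c zero    = a
trib a b c (suc n) = trib b c (a + b + c) n

-- The shift is written on the left so that T (+ 3 + + n) computes by the forward recurrence.
IsTribonacci : (ℤ → ℤ) → Set
IsTribonacci t = ∀ r → t (+ 3 + r) ≡ t r + t (+ 1 + r) + t (+ 2 + r)

tribonacci-window : ∀ t → IsTribonacci t →
                    ∀ r i → t (+ i + r) ≡ trib (t r) (t (+ 1 + r)) (t (+ 2 + r)) i
tribonacci-window t rec r zero    = cong t (+-identityˡ r)
tribonacci-window t rec r (suc i) = begin
  t (+ suc i + r)
    ≡⟨ cong t (shift (+ i) r) ⟩
  t (+ i + (+ 1 + r))
    ≡⟨ tribonacci-window t rec (+ 1 + r) i ⟩
  trib (t (+ 1 + r)) (t (+ 1 + (+ 1 + r))) (t (+ 2 + (+ 1 + r))) i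
    ≡⟨ cong₂ (λ u v → trib (t (+ 1 + r)) u v i)
             (cong t (sym (+-assoc (+ 1) (+ 1) r)))
             (trans (cong t (sym (+-assoc (+ 2) (+ 1) r))) (rec r)) ⟩
  trib (t (+ 1 + r)) (t (+ 2 + r)) (t r + t (+ 1 + r) + t (+ 2 + r)) i ∎
  where
  shift : ∀ x r → (+ 1 + x) + r ≡ x + (+ 1 + r)
  shift = solve-∀

T-isTribonacci : IsTribonacci T
T-isTribonacci (+ n)                      = refl
T-isTribonacci -[1+ 0 ]                   = refl
T-isTribonacci -[1+ 1 ]                   = refl
T-isTribonacci -[1+ 2 ]                   = refl
-- Three backward steps followed by one forward step return the starting value.
T-isTribonacci -[1+ suc (suc (suc n)) ]   = cancel _ _ _
  where
  cancel : ∀ a u v → a ≡ a - u - v + v + u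
  cancel = solve-∀

Φ : (ℕ → ℤ) → ℤ
Φ s = + 15 * sq (s 4) + + 4 * sq (s 3) - + 2 * sq (s 1) - sq (s 0)

Φ-trib-shift : ∀ a b c →
               Φ (trib a b c ∘ (4 ℕ.+_)) ≡ Φ (trib a b c) + + 16 * sq (trib a b c 8)
Φ-trib-shift = identity
  where
  identity : ∀ t₀ t₁ t₂ →
    let t₃ = t₀ + t₁ + t₂ ; t₄ = t₁ + t₂ + t₃ ; t₅ = t₂ + t₃ + t₄
        t₆ = t₃ + t₄ + t₅ ; t₇ = t₄ + t₅ + t₆ ; t₈ = t₅ + t₆ + t₇ in
    + 15 * (t₈ * t₈) + + 4 * (t₇ * t₇) - + 2 * (t₅ * t₅) - t₄ * t₄
      ≡ + 15 * (t₄ * t₄) + + 4 * (t₃ * t₃) - + 2 * (t₁ * t₁) - t₀ * t₀ + + 16 * (t₈ * t₈)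
  identity = solve-∀

Φ-cong : ∀ s s′ → s 0 ≡ s′ 0 → s 1 ≡ s′ 1 → s 3 ≡ s′ 3 → s 4 ≡ s′ 4 → Φ s ≡ Φ s′
Φ-cong s s′ e₀ e₁ e₃ e₄ =
  cong₂ _-_ (cong₂ _-_ (cong₂ _+_ (cong (λ x → + 15 * sq x) e₄) (cong (λ x → + 4 * sq x) e₃))
                       (cong (λ x → + 2 * sq x) e₁))
            (cong sq e₀)

Φ-shift : ∀ t → IsTribonacci t → ∀ r →
          Φ (λ i → t (+ (4 ℕ.+ i) + r)) ≡ Φ (λ i → t (+ i + r)) + + 16 * sq (t (+ 8 + r))
Φ-shift t rec r = begin
  Φ (λ i → t (+ (4 ℕ.+ i) + r))
    ≡⟨ Φ-cong (λ i → t (+ (4 ℕ.+ i) + r)) (trib a b c ∘ (4 ℕ.+_))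
              (t≡trib 4) (t≡trib 5) (t≡trib 7) (t≡trib 8) ⟩
  Φ (trib a b c ∘ (4 ℕ.+_))
    ≡⟨ Φ-trib-shift a b c ⟩
  Φ (trib a b c) + + 16 * sq (trib a b c 8)
    ≡⟨ sym (cong₂ (λ u v → u + + 16 * sq v)
                  (Φ-cong (λ i → t (+ i + r)) (trib a b c)
                          (t≡trib 0) (t≡trib 1) (t≡trib 3) (t≡trib 4))
                  (t≡trib 8)) ⟩
  Φ (λ i → t (+ i + r)) + + 16 * sq (t (+ 8 + r)) ∎
  where
  a = t r
  b = t (+ 1 + r)
  c = t (+ 2 + r)
  t≡trib : ∀ i → t (+ i + r) ≡ trib a b c i
  t≡trib = tribonacci-window t rec r

T-window : ℕ → ℕ → ℤ
T-window k i = T (+ i + (+ 4 * + k - + 5))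

Φ-T-window : ∀ k → Φ (T-window k)
  ≡ + 15 * sq (T (+ 4 * + k - + 1)) + + 4 * sq (T (+ 4 * + k - + 2))
    - + 2 * sq (T (+ 4 * + k - + 4)) - sq (T (+ 4 * + k - + 5))
Φ-T-window k = Φ-cong (T-window k) (λ i → T (+ 4 * + k - (+ 5 - + i)))
                    (index (+ 0)) (index (+ 1)) (index (+ 3)) (index (+ 4))
  where
  shift : ∀ x y → y + (x - + 5) ≡ x - (+ 5 - y)
  shift = solve-∀
  index : ∀ y → T (y + (+ 4 * + k - + 5)) ≡ T (+ 4 * + k - (+ 5 - y))
  index y = cong T (shift (+ 4 * + k) y)

Φ-T-window-suc : ∀ k →
  Φ (T-window (suc k)) ≡ Φ (T-window k) + + 16 * sq (T (+ 4 * + suc k - + 1))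
Φ-T-window-suc k = begin
  Φ (T-window (suc k))
    ≡⟨ Φ-cong (T-window (suc k)) (λ i → T (+ (4 ℕ.+ i) + r))
              (index (+ 0)) (index (+ 1)) (index (+ 3)) (index (+ 4)) ⟩
  Φ (λ i → T (+ (4 ℕ.+ i) + r))
    ≡⟨ Φ-shift T T-isTribonacci r ⟩
  Φ (T-window k) + + 16 * sq (T (+ 8 + r))
    ≡⟨ cong (λ z → Φ (T-window k) + + 16 * sq (T z)) (last (+ k)) ⟩
  Φ (T-window k) + + 16 * sq (T (+ 4 * + suc k - + 1)) ∎
  where
  r = + 4 * + k - + 5
  shift : ∀ x y → y + (+ 4 * (+ 1 + x) - + 5) ≡ (+ 4 + y) + (+ 4 * x - + 5)
  shift = solve-∀
  index : ∀ y → T (y + (+ 4 * + suc k - + 5)) ≡ T ((+ 4 + y) + r)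
  index y = cong T (shift (+ k) y)
  last : ∀ x → + 8 + (+ 4 * x - + 5) ≡ + 4 * (+ 1 + x) - + 1
  last = solve-∀

mainTheorem12 : (k : ℕ) →
    + 16 * sumTo k (λ j → sq (T (+ 4 * + j - + 1)))
      ≡ + 15 * sq (T (+ 4 * + k - + 1)) + + 4 * sq (T (+ 4 * + k - + 2))
        - + 2 * sq (T (+ 4 * + k - + 4)) - sq (T (+ 4 * + k - + 5))
mainTheorem12 zero    = refl
mainTheorem12 (suc k) = begin
  + 16 * sumTo (suc k) f
    ≡⟨ cong (_*_ (+ 16)) (sumTo-suc k f) ⟩
  + 16 * (sumTo k f + f (suc k))
    ≡⟨ *-distribˡ-+ (+ 16) (sumTo k f) (f (suc k)) ⟩
  + 16 * sumTo k f + + 16 * f (suc k)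
    ≡⟨ cong (_+ + 16 * f (suc k)) (trans (mainTheorem12 k) (sym (Φ-T-window k))) ⟩
  Φ (T-window k) + + 16 * f (suc k)
    ≡⟨ sym (Φ-T-window-suc k) ⟩
  Φ (T-window (suc k))
    ≡⟨ Φ-T-window (suc k) ⟩
  + 15 * sq (T (+ 4 * + suc k - + 1)) + + 4 * sq (T (+ 4 * + suc k - + 2))
    - + 2 * sq (T (+ 4 * + suc k - + 4)) - sq (T (+ 4 * + suc k - + 5)) ∎
  where
  f : ℕ → ℤ
  f j = sq (T (+ 4 * + j - + 1))
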